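{- (Simultaneous substitution.) If $\Phi;\Delta\vdash_1 t:T$ and $\Psi;\Gamma\vdash\sigma;\delta:\Phi;\Delta$, then $\Psi;\Gamma\vdash_1 t[\sigma;\delta]:T$.
   Context: Types: $T::=\mathsf{Nat}\mid\square T\mid S\to T$. $\mathrm{core}\,T$: $T$ built from $\mathsf{Nat}$ and $\to$ only. $\mathrm{type}\,T$: $\mathsf{Nat}$; $S\to T$ with $S,T$ valid; $\square T$ with $\mathrm{core}\,T$. Local contexts $\Gamma,\Delta::=\cdot\mid\Gamma,x:T$, global contexts $\Psi,\Phi::=\cdot\mid\Psi,u:T$; $\mathrm{core},\mathrm{type}$ extend pointwise. Terms $t::=x\mid u\mid\mathsf{zero}\mid\mathsf{succ}\,t\mid\mathsf{box}\,t\mid\mathsf{letbox}\,u=s\,\mathsf{in}\,t\mid\lambda x.t\mid s\ t$. Typing $\Psi;\Gamma\vdash_i t:T$ ($i\in\{0,1\}$), with $C_0$="$\mathrm{core}\,\Psi$, $\mathrm{core}\,\Gamma$", $C_1$="$\mathrm{core}\,\Psi$, $\mathrm{type}\,\Gamma$": under $C_i$, $\vdash_i\mathsf{zero}:\mathsf{Nat}$, $\vdash_i u:T$ for $u:T\in\Psi$, $\vdash_i x:T$ for $x:T\in\Gamma$; succ preserves $\mathsf{Nat}$ at layer $i$; $\Psi;\Gamma,x:S\vdash_i t:T\Rightarrow\Psi;\Gamma\vdash_i\lambda x.t:S\to T$; application at layer $i$; $\mathrm{type}\,\Gamma$ and $\Psi;\cdot\vdash_0 t:T$ give $\Psi;\Gamma\vdash_1\mathsf{box}\,t:\square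 T$; $\Psi;\Gamma\vdash_1 s:\square T$ and $\Psi,u:T;\Gamma\vdash_1 t:T'$ give $\Psi;\Gamma\vdash_1\mathsf{letbox}\,u=s\,\mathsf{in}\,t:T'$. Global substitutions $\sigma::=\cdot\mid\sigma,t/u$: $\Psi\vdash\cdot:\cdot$ if $\mathrm{core}\,\Psi$; $\Psi\vdash\sigma,t/u:\Phi,u:T$ if $\Psi\vdash\sigma:\Phi$ and $\Psi;\cdot\vdash_0 t:T$. Local substitutions $\delta::=\cdot\mid\delta,t/x$: $\Psi;\Gamma\vdash\cdot:\cdot$ if $\mathrm{core}\,\Psi$, $\mathrm{type}\,\Gamma$; $\Psi;\Gamma\vdash\delta,t/x:\Delta,x:T$ if $\Psi;\Gamma\vdash\delta:\Delta$ and $\Psi;\Gamma\vdash_1 t:T$. $\Psi;\Gamma\vdash\sigma;\delta:\Phi;\Delta$ iff $\Psi\vdash\sigma:\Phi$ and $\Psi;\Gamma\vdash\delta:\Delta$. Global application: $x[\sigma]=x$, $u[\sigma]=\sigma(u)$, $(\mathsf{box}\,t)[\sigma]=\mathsf{box}(t[\sigma])$, $(\mathsf{letbox}\,u=s\,\mathsf{in}\,t)[\sigma]=\mathsf{letbox}\,u=s[\sigma]\,\mathsf{in}\,(t[\sigma,u/u])$, homomorphic otherwise. Local application: $x[\delta]=\delta(x)$, $u[\delta]=u$, $(\mathsf{box}\,t)[\delta]=\mathsf{box}\,t$, $(\lambda x.t)[\delta]=\lambda x.(t[\delta,x/x])$, homomorphic otherwise. $t[\sigma;\delta]:=t[\sigma][\delta]$.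 -}

module Defs where

open import Data.Nat using (ℕ; zero; suc)
open import Data.List using (List; []; _∷_)
open import Data.Unit using (⊤; tt)
open import Data.Empty using (⊥)
open import Data.Product using (_×_)

data Ty : Set where
  Nat  : Ty
  □_   : Ty → Ty
  _⇒_  : Ty → Ty → Ty

core : Ty → Set
core Nat     = ⊤
core (□ _)   = ⊥
core (S ⇒ T) = core S × core T

type : Ty → Set
type Nat     = ⊤
type (□ T)   = core T
type (S ⇒ T) = type S × type T

-- Contexts (local and global), as snoc lists represented by List with
-- the most recent binding at the head.  Variables are de Bruijn indices
-- (names up to α-equivalence); the head is index 0.
Ctx : Set
Ctx = List Ty

data All (P : Ty → Set) : Ctx → Set where
  []  : All P []
  _∷_ : ∀ {T Γ} → P T → All P Γ → All P (T ∷ Γ)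

coreC : Ctx → Set
coreC = All core

typeC : Ctx → Set
typeC = All type

data _⦂_∈_ : ℕ → Ty → Ctx → Set where
  here  : ∀ {T Γ} → zero ⦂ T ∈ (T ∷ Γ)
  there : ∀ {n S T Γ} → n ⦂ T ∈ Γ → suc n ⦂ T ∈ (S ∷ Γ)

-- Terms: local variables x (index into Γ), global variables u (index
-- into Ψ).  λ binds a local variable, letbox binds a global variable.
data Tm : Set where
  lvar   : ℕ → Tm
  gvar   : ℕ → Tm
  zero'  : Tm
  succ   : Tm → Tm
  box    : Tm → Tm
  letbox : Tm → Tm → Tm   -- letbox u = s in t ; t under one more global
  lam    : Tm → Tm        -- λ x . t ; t under one more local
  app    : Tm → Tm → Tm

data Layer : Set where
  l0 l1 : Layer

Cond : Layer → Ctx → Ctx → Set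
Cond l0 Ψ Γ = coreC Ψ × coreC Γ
Cond l1 Ψ Γ = coreC Ψ × typeC Γ

data _﹔_⊢[_]_∶_ : Ctx → Ctx → Layer → Tm → Ty → Set where
  t-zero : ∀ {Ψ Γ i} → Cond i Ψ Γ → Ψ ﹔ Γ ⊢[ i ] zero' ∶ Nat
  t-gvar : ∀ {Ψ Γ i u T} → Cond i Ψ Γ → u ⦂ T ∈ Ψ → Ψ ﹔ Γ ⊢[ i ] gvar u ∶ T
  t-lvar : ∀ {Ψ Γ i x T} → Cond i Ψ Γ → x ⦂ T ∈ Γ → Ψ ﹔ Γ ⊢[ i ] lvar x ∶ T
  t-succ : ∀ {Ψ Γ i t} → Ψ ﹔ Γ ⊢[ i ] t ∶ Nat → Ψ ﹔ Γ ⊢[ i ] succ t ∶ Nat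
  t-lam  : ∀ {Ψ Γ i t S T} → Ψ ﹔ (S ∷ Γ) ⊢[ i ] t ∶ T → Ψ ﹔ Γ ⊢[ i ] lam t ∶ (S ⇒ T)
  t-app  : ∀ {Ψ Γ i s t S T} → Ψ ﹔ Γ ⊢[ i ] s ∶ (S ⇒ T) → Ψ ﹔ Γ ⊢[ i ] t ∶ S →
           Ψ ﹔ Γ ⊢[ i ] app s t ∶ T
  t-box  : ∀ {Ψ Γ t T} → typeC Γ → Ψ ﹔ [] ⊢[ l0 ] t ∶ T → Ψ ﹔ Γ ⊢[ l1 ] box t ∶ (□ T)
  t-letbox : ∀ {Ψ Γ s t T T'} → Ψ ﹔ Γ ⊢[ l1 ] s ∶ (□ T) → (T ∷ Ψ) ﹔ Γ ⊢[ l1 ] t ∶ T' →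
             Ψ ﹔ Γ ⊢[ l1 ] letbox s t ∶ T'

-- Renamings/shifts (needed to push substitutions under binders with
-- de Bruijn indices; these realise the "u/u" and "x/x" extensions).
liftR : (ℕ → ℕ) → ℕ → ℕ
liftR ρ zero    = zero
liftR ρ (suc n) = suc (ρ n)

renL : (ℕ → ℕ) → Tm → Tm
renL ρ (lvar x)     = lvar (ρ x)
renL ρ (gvar u)     = gvar u
renL ρ zero'        = zero'
renL ρ (succ t)     = succ (renL ρ t)
renL ρ (box t)      = box t
renL ρ (letbox s t) = letbox (renL ρ s) (renL ρ t)
renL ρ (lam t)      = lam (renL (liftR ρ) t)
renL ρ (app s t)    = app (renL ρ s) (renL ρ t)

renG : (ℕ → ℕ) → Tm → Tm
renG ρ (lvar x)     = lvar x
renG ρ (gvar u)     = gvar (ρ u)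
renG ρ zero'        = zero'
renG ρ (succ t)     = succ (renG ρ t)
renG ρ (box t)      = box (renG ρ t)
renG ρ (letbox s t) = letbox (renG ρ s) (renG (liftR ρ) t)
renG ρ (lam t)      = lam (renG ρ t)
renG ρ (app s t)    = app (renG ρ s) (renG ρ t)

-- Substitutions: σ ::= · | σ , t/u  (head = most recent entry)
Sub : Set
Sub = List Tm

lookupS : (ℕ → Tm) → Sub → ℕ → Tm   -- default for out-of-range indices
lookupS d []      n       = d n
lookupS d (t ∷ σ) zero    = t
lookupS d (t ∷ σ) (suc n) = lookupS d σ n

mapS : (Tm → Tm) → Sub → Sub
mapS f []      = []
mapS f (t ∷ σ) = f t ∷ mapS f σ

-- Global substitution application  t[σ]
-- (letbox u = s in t)[σ] = letbox u = s[σ] in t[σ, u/u]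
gsub : Sub → Tm → Tm
gsub σ (lvar x)     = lvar x
gsub σ (gvar u)     = lookupS gvar σ u
gsub σ zero'        = zero'
gsub σ (succ t)     = succ (gsub σ t)
gsub σ (box t)      = box (gsub σ t)
gsub σ (letbox s t) = letbox (gsub σ s) (gsub (gvar zero ∷ mapS (renG suc) σ) t)
gsub σ (lam t)      = lam (gsub σ t)
gsub σ (app s t)    = app (gsub σ s) (gsub σ t)

-- Local substitution application  t[δ]
-- u[δ] = u,  (box t)[δ] = box t,  (λx.t)[δ] = λx.(t[δ, x/x])
lsub : Sub → Tm → Tm
lsub δ (lvar x)     = lookupS lvar δ x
lsub δ (gvar u)     = gvar u
lsub δ zero'        = zero'
lsub δ (succ t)     = succ (lsub δ t)
lsub δ (box t)      = box t
lsub δ (letbox s t) = letbox (lsub δ s) (lsub (mapS (renG suc) δ) t)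
lsub δ (lam t)      = lam (lsub (lvar zero ∷ mapS (renL suc) δ) t)
lsub δ (app s t)    = app (lsub δ s) (lsub δ t)

_[_﹔_] : Tm → Sub → Sub → Tm
t [ σ ﹔ δ ] = lsub δ (gsub σ t)

data _⊢g_∶_ : Ctx → Sub → Ctx → Set where
  g-nil  : ∀ {Ψ} → coreC Ψ → Ψ ⊢g [] ∶ []
  g-cons : ∀ {Ψ σ Φ t T} → Ψ ⊢g σ ∶ Φ → Ψ ﹔ [] ⊢[ l0 ] t ∶ T → Ψ ⊢g (t ∷ σ) ∶ (T ∷ Φ)

data _﹔_⊢l_∶_ : Ctx → Ctx → Sub → Ctx → Set where
  l-nil  : ∀ {Ψ Γ} → coreC Ψ → typeC Γ → Ψ ﹔ Γ ⊢l [] ∶ []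
  l-cons : ∀ {Ψ Γ δ Δ t T} → Ψ ﹔ Γ ⊢l δ ∶ Δ → Ψ ﹔ Γ ⊢[ l1 ] t ∶ T →
           Ψ ﹔ Γ ⊢l (t ∷ δ) ∶ (T ∷ Δ)

_﹔_⊢_﹔_∶_﹔_ : Ctx → Ctx → Sub → Sub → Ctx → Ctx → Set
Ψ ﹔ Γ ⊢ σ ﹔ δ ∶ Φ ﹔ Δ = (Ψ ⊢g σ ∶ Φ) × (Ψ ﹔ Γ ⊢l δ ∶ Δ)

module Submission where

-- Both substitutions are pushed through the typing derivation separately, since
-- t[σ;δ] = t[σ][δ].  Global substitution works at either layer: the substituted
-- terms are closed layer-0 terms, which can be weakened to any local context and
-- lifted to layer 1 because core types are valid types.  Local substitution only
-- needs layer 1: it never enters a box, whose body is closed in the local context.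
-- Pushing either substitution under a binder needs weakening of the substituted
-- terms, i.e. preservation of typing under renamings of either kind of variable.

open import Defs
open import Data.Nat using (ℕ; suc)
open import Data.List using ([]; _∷_; _++_)
open import Data.Unit using (tt)
open import Data.Product using (_×_; _,_; proj₁; proj₂)

core⇒type : ∀ {T} → core T → type T
core⇒type {Nat}   _       = tt
core⇒type {S ⇒ T} (s , t) = core⇒type s , core⇒type t

coreC⇒typeC : ∀ {Γ} → coreC Γ → typeC Γ
coreC⇒typeC []       = []
coreC⇒typeC (c ∷ cs) = core⇒type c ∷ coreC⇒typeC cs

All-head : ∀ {P T Γ} → All P (T ∷ Γ) → P T
All-head (p ∷ _) = p

All-tail : ∀ {P T Γ} → All P (T ∷ Γ) → All P Γ
All-tail (_ ∷ ps) = ps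

LocalTy : Layer → Ty → Set
LocalTy l0 = core
LocalTy l1 = type

LocalCond : Layer → Ctx → Set
LocalCond i = All (LocalTy i)

Cond-global : ∀ {i Ψ Γ} → Cond i Ψ Γ → coreC Ψ
Cond-global {l0} = proj₁
Cond-global {l1} = proj₁

Cond-local : ∀ {i Ψ Γ} → Cond i Ψ Γ → LocalCond i Γ
Cond-local {l0} = proj₂
Cond-local {l1} = proj₂

mkCond : ∀ {i Ψ Γ} → coreC Ψ → LocalCond i Γ → Cond i Ψ Γ
mkCond {l0} = _,_
mkCond {l1} = _,_

Cond-∷ : ∀ {i Ψ Γ S} → LocalTy i S → Cond i Ψ Γ → Cond i Ψ (S ∷ Γ)
Cond-∷ k c = mkCond (Cond-global c) (k ∷ Cond-local c)

⊢⇒Cond : ∀ {Ψ Γ i t T} → Ψ ﹔ Γ ⊢[ i ] t ∶ T → Cond i Ψ Γ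
⊢⇒Cond (t-zero c)     = c
⊢⇒Cond (t-gvar c _)   = c
⊢⇒Cond (t-lvar c _)   = c
⊢⇒Cond (t-succ d)     = ⊢⇒Cond d
⊢⇒Cond (t-lam d)      = mkCond (Cond-global (⊢⇒Cond d)) (All-tail (Cond-local (⊢⇒Cond d)))
⊢⇒Cond (t-app d _)    = ⊢⇒Cond d
⊢⇒Cond (t-box γ d)    = proj₁ (⊢⇒Cond d) , γ
⊢⇒Cond (t-letbox d _) = ⊢⇒Cond d

⊢-l0⇒l1 : ∀ {Ψ Γ t T} → Ψ ﹔ Γ ⊢[ l0 ] t ∶ T → Ψ ﹔ Γ ⊢[ l1 ] t ∶ T
⊢-l0⇒l1 (t-zero (ψ , γ))   = t-zero (ψ , coreC⇒typeC γ)
⊢-l0⇒l1 (t-gvar (ψ , γ) m) = t-gvar (ψ , coreC⇒typeC γ) m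
⊢-l0⇒l1 (t-lvar (ψ , γ) m) = t-lvar (ψ , coreC⇒typeC γ) m
⊢-l0⇒l1 (t-succ d)         = t-succ (⊢-l0⇒l1 d)
⊢-l0⇒l1 (t-lam d)          = t-lam (⊢-l0⇒l1 d)
⊢-l0⇒l1 (t-app d e)        = t-app (⊢-l0⇒l1 d) (⊢-l0⇒l1 e)

⊢-l0⇒ : ∀ {i Ψ Γ t T} → Ψ ﹔ Γ ⊢[ l0 ] t ∶ T → Ψ ﹔ Γ ⊢[ i ] t ∶ T
⊢-l0⇒ {l0} d = d
⊢-l0⇒ {l1} d = ⊢-l0⇒l1 d

∈-++⁺ˡ : ∀ {x T} Γ₁ {Γ₂} → x ⦂ T ∈ Γ₁ → x ⦂ T ∈ (Γ₁ ++ Γ₂)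
∈-++⁺ˡ (_ ∷ _)  here      = here
∈-++⁺ˡ (_ ∷ Γ₁) (there m) = there (∈-++⁺ˡ Γ₁ m)

⊢-weaken-++ : ∀ {Ψ Γ₁ Γ₂ i t T} → Ψ ﹔ Γ₁ ⊢[ i ] t ∶ T →
              Cond i Ψ (Γ₁ ++ Γ₂) → Ψ ﹔ (Γ₁ ++ Γ₂) ⊢[ i ] t ∶ T
⊢-weaken-++ (t-zero _)           c = t-zero c
⊢-weaken-++ (t-gvar _ m)         c = t-gvar c m
⊢-weaken-++ {Γ₁ = Γ₁} (t-lvar _ m) c = t-lvar c (∈-++⁺ˡ Γ₁ m)
⊢-weaken-++ (t-succ d)           c = t-succ (⊢-weaken-++ d c)
⊢-weaken-++ (t-lam d)            c =
  t-lam (⊢-weaken-++ d (Cond-∷ (All-head (Cond-local (⊢⇒Cond d))) c))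
⊢-weaken-++ (t-app d e)          c = t-app (⊢-weaken-++ d c) (⊢-weaken-++ e c)
⊢-weaken-++ (t-box _ d)          c = t-box (proj₂ c) d
⊢-weaken-++ (t-letbox d e)       c =
  t-letbox (⊢-weaken-++ d c) (⊢-weaken-++ e (proj₁ (⊢⇒Cond e) , proj₂ c))

_∶_⇒ʳ_ : (ℕ → ℕ) → Ctx → Ctx → Set
ρ ∶ Γ ⇒ʳ Γ′ = ∀ {x T} → x ⦂ T ∈ Γ → ρ x ⦂ T ∈ Γ′

liftR-⇒ʳ : ∀ {ρ Γ Γ′ S} → ρ ∶ Γ ⇒ʳ Γ′ → liftR ρ ∶ (S ∷ Γ) ⇒ʳ (S ∷ Γ′)
liftR-⇒ʳ r here      = here
liftR-⇒ʳ r (there m) = there (r m)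

⊢-renL : ∀ {Ψ Γ Γ′ i t T ρ} → Ψ ﹔ Γ ⊢[ i ] t ∶ T → ρ ∶ Γ ⇒ʳ Γ′ →
         Cond i Ψ Γ′ → Ψ ﹔ Γ′ ⊢[ i ] renL ρ t ∶ T
⊢-renL (t-zero _)     r c = t-zero c
⊢-renL (t-gvar _ m)   r c = t-gvar c m
⊢-renL (t-lvar _ m)   r c = t-lvar c (r m)
⊢-renL (t-succ d)     r c = t-succ (⊢-renL d r c)
⊢-renL (t-lam d)      r c =
  t-lam (⊢-renL d (liftR-⇒ʳ r) (Cond-∷ (All-head (Cond-local (⊢⇒Cond d))) c))
⊢-renL (t-app d e)    r c = t-app (⊢-renL d r c) (⊢-renL e r c)
⊢-renL (t-box _ d)    r c = t-box (proj₂ c) d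
⊢-renL (t-letbox d e) r c = t-letbox (⊢-renL d r c) (⊢-renL e r (proj₁ (⊢⇒Cond e) , proj₂ c))

⊢-renG : ∀ {Ψ Ψ′ Γ i t T ρ} → Ψ ﹔ Γ ⊢[ i ] t ∶ T → ρ ∶ Ψ ⇒ʳ Ψ′ →
         coreC Ψ′ → Ψ′ ﹔ Γ ⊢[ i ] renG ρ t ∶ T
⊢-renG (t-zero c)     r ψ = t-zero (mkCond ψ (Cond-local c))
⊢-renG (t-gvar c m)   r ψ = t-gvar (mkCond ψ (Cond-local c)) (r m)
⊢-renG (t-lvar c m)   r ψ = t-lvar (mkCond ψ (Cond-local c)) m
⊢-renG (t-succ d)     r ψ = t-succ (⊢-renG d r ψ)
⊢-renG (t-lam d)      r ψ = t-lam (⊢-renG d r ψ)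
⊢-renG (t-app d e)    r ψ = t-app (⊢-renG d r ψ) (⊢-renG e r ψ)
⊢-renG (t-box γ d)    r ψ = t-box γ (⊢-renG d r ψ)
⊢-renG (t-letbox d e) r ψ =
  t-letbox (⊢-renG d r ψ) (⊢-renG e (liftR-⇒ʳ r) (All-head (proj₁ (⊢⇒Cond e)) ∷ ψ))

⊢g⇒coreC : ∀ {Ψ σ Φ} → Ψ ⊢g σ ∶ Φ → coreC Ψ
⊢g⇒coreC (g-nil ψ)    = ψ
⊢g⇒coreC (g-cons s _) = ⊢g⇒coreC s

⊢g-lookup : ∀ {Ψ σ Φ u T} → Ψ ⊢g σ ∶ Φ → u ⦂ T ∈ Φ → Ψ ﹔ [] ⊢[ l0 ] lookupS gvar σ u ∶ T
⊢g-lookup (g-cons _ d) here      = d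
⊢g-lookup (g-cons s _) (there m) = ⊢g-lookup s m

⊢g-weaken : ∀ {Ψ σ Φ S} → core S → Ψ ⊢g σ ∶ Φ → (S ∷ Ψ) ⊢g mapS (renG suc) σ ∶ Φ
⊢g-weaken k (g-nil ψ)    = g-nil (k ∷ ψ)
⊢g-weaken k (g-cons s d) = g-cons (⊢g-weaken k s) (⊢-renG d there (k ∷ ⊢g⇒coreC s))

⊢g-lift : ∀ {Ψ σ Φ S} → core S → Ψ ⊢g σ ∶ Φ → (S ∷ Ψ) ⊢g (gvar 0 ∷ mapS (renG suc) σ) ∶ (S ∷ Φ)
⊢g-lift k s = g-cons (⊢g-weaken k s) (t-gvar (k ∷ ⊢g⇒coreC s , []) here)

⊢-gsub : ∀ {Φ Ψ Δ i t T σ} → Φ ﹔ Δ ⊢[ i ] t ∶ T → Ψ ⊢g σ ∶ Φ → Ψ ﹔ Δ ⊢[ i ] gsub σ t ∶ T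
⊢-gsub (t-zero c)     s = t-zero (mkCond (⊢g⇒coreC s) (Cond-local c))
⊢-gsub (t-gvar c m)   s =
  ⊢-weaken-++ {Γ₁ = []} (⊢-l0⇒ (⊢g-lookup s m)) (mkCond (⊢g⇒coreC s) (Cond-local c))
⊢-gsub (t-lvar c m)   s = t-lvar (mkCond (⊢g⇒coreC s) (Cond-local c)) m
⊢-gsub (t-succ d)     s = t-succ (⊢-gsub d s)
⊢-gsub (t-lam d)      s = t-lam (⊢-gsub d s)
⊢-gsub (t-app d e)    s = t-app (⊢-gsub d s) (⊢-gsub e s)
⊢-gsub (t-box γ d)    s = t-box γ (⊢-gsub d s)
⊢-gsub (t-letbox d e) s = t-letbox (⊢-gsub d s) (⊢-gsub e (⊢g-lift (All-head (proj₁ (⊢⇒Cond e))) s))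

⊢l⇒Cond : ∀ {Ψ Γ δ Δ} → Ψ ﹔ Γ ⊢l δ ∶ Δ → coreC Ψ × typeC Γ
⊢l⇒Cond (l-nil ψ γ)  = ψ , γ
⊢l⇒Cond (l-cons s _) = ⊢l⇒Cond s

⊢l-lookup : ∀ {Ψ Γ δ Δ x T} → Ψ ﹔ Γ ⊢l δ ∶ Δ → x ⦂ T ∈ Δ → Ψ ﹔ Γ ⊢[ l1 ] lookupS lvar δ x ∶ T
⊢l-lookup (l-cons _ d) here      = d
⊢l-lookup (l-cons s _) (there m) = ⊢l-lookup s m

⊢l-weakenG : ∀ {Ψ Γ δ Δ S} → core S → Ψ ﹔ Γ ⊢l δ ∶ Δ → (S ∷ Ψ) ﹔ Γ ⊢l mapS (renG suc) δ ∶ Δ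
⊢l-weakenG k (l-nil ψ γ)  = l-nil (k ∷ ψ) γ
⊢l-weakenG k (l-cons s d) = l-cons (⊢l-weakenG k s) (⊢-renG d there (k ∷ proj₁ (⊢l⇒Cond s)))

⊢l-weakenL : ∀ {Ψ Γ δ Δ S} → type S → Ψ ﹔ Γ ⊢l δ ∶ Δ → Ψ ﹔ (S ∷ Γ) ⊢l mapS (renL suc) δ ∶ Δ
⊢l-weakenL k (l-nil ψ γ)  = l-nil ψ (k ∷ γ)
⊢l-weakenL k (l-cons s d) =
  l-cons (⊢l-weakenL k s) (⊢-renL d there (proj₁ (⊢l⇒Cond s) , k ∷ proj₂ (⊢l⇒Cond s)))

⊢l-lift : ∀ {Ψ Γ δ Δ S} → type S → Ψ ﹔ Γ ⊢l δ ∶ Δ →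
          Ψ ﹔ (S ∷ Γ) ⊢l (lvar 0 ∷ mapS (renL suc) δ) ∶ (S ∷ Δ)
⊢l-lift k s = l-cons (⊢l-weakenL k s) (t-lvar (proj₁ (⊢l⇒Cond s) , k ∷ proj₂ (⊢l⇒Cond s)) here)

⊢-lsub : ∀ {Ψ Γ Δ t T δ} → Ψ ﹔ Δ ⊢[ l1 ] t ∶ T → Ψ ﹔ Γ ⊢l δ ∶ Δ → Ψ ﹔ Γ ⊢[ l1 ] lsub δ t ∶ T
⊢-lsub (t-zero _)     s = t-zero (⊢l⇒Cond s)
⊢-lsub (t-gvar _ m)   s = t-gvar (⊢l⇒Cond s) m
⊢-lsub (t-lvar _ m)   s = ⊢l-lookup s m
⊢-lsub (t-succ d)     s = t-succ (⊢-lsub d s)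
⊢-lsub (t-lam d)      s = t-lam (⊢-lsub d (⊢l-lift (All-head (proj₂ (⊢⇒Cond d))) s))
⊢-lsub (t-app d e)    s = t-app (⊢-lsub d s) (⊢-lsub e s)
⊢-lsub (t-box _ d)    s = t-box (proj₂ (⊢l⇒Cond s)) d
⊢-lsub (t-letbox d e) s = t-letbox (⊢-lsub d s) (⊢-lsub e (⊢l-weakenG (All-head (proj₁ (⊢⇒Cond e))) s))

mainTheorem8 : ∀ {Φ Δ Ψ Γ t T σ δ} →
    Φ ﹔ Δ ⊢[ l1 ] t ∶ T →
    Ψ ﹔ Γ ⊢ σ ﹔ δ ∶ Φ ﹔ Δ →
    Ψ ﹔ Γ ⊢[ l1 ] t [ σ ﹔ δ ] ∶ T
mainTheorem8 d (σ-ok , δ-ok) = ⊢-lsub (⊢-gsub d σ-ok) δ-ok
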